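{- Let $q\ge1$ be an integer and $I\subseteq\{0,1,\dots,q-1\}$. Let $k_1,k_2\ge0$, $p_i,q_i\ge0$ be integers and $s_i,a_{ij},t_i,b_{ij},a,\nu$ integers. Then $\lceil n/q\rceil$ formally satisfies $$R(n)=\sum_{i=1}^{k_1}R\Big(n-s_i-\sum_{j=1}^{p_i}R(n-a_{ij})\Big)+\sum_{i=1}^{k_2}R\Big(-t_i+\sum_{j=1}^{q_i}R(n-b_{ij})\Big)+R\Big(n-a-\sum_{j\in I}R(n-j)\Big)+\nu$$ if and only if it formally satisfies $$R(n)=\sum_{i=1}^{k_1}R\Big(n-s_i-\sum_{j=1}^{p_i}R(n-a_{ij})\Big)+\sum_{i=1}^{k_2}R\Big(-t_i+\sum_{j=1}^{q_i}R(n-b_{ij})\Big)+R\Big(-a+\sum_{j\in\{0,\dots,q-1\}\setminus I}R(n-j)\Big)+\nu.$$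
   Context: Empty sums are $0$. A sequence $B$ formally satisfies a recursion if for every $n$, replacing every occurrence of $R$ by $B$ (with $B(m)=\lceil m/q\rceil$ for all integers $m$) yields a true equality. -}

module Defs where

open import Data.Nat as ℕ using (ℕ; zero; suc; NonZero)
open import Data.Integer using (ℤ; +_; -_; _+_; _-_; _/ℕ_)
open import Data.Fin as Fin using (Fin; toℕ)
open import Data.Fin.Subset as Sub using ()
open import Relation.Binary.PropositionalEquality using (_≡_)
open import Data.Fin.Subset using (Subset; Side; inside; outside)
open import Data.Vec using ([]; _∷_)

-- ⌈ m / q ⌉ for q ≥ 1 ; _/ℕ_ is floor division, so ⌈m/q⌉ = - ⌊ -m / q ⌋
ceilDiv : ℤ → (q : ℕ) → .{{NonZero q}} → ℤ
ceilDiv m q = - ((- m) /ℕ q)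

Σ : (n : ℕ) → (Fin n → ℤ) → ℤ
Σ zero    f = + 0
Σ (suc n) f = f Fin.zero + Σ n (λ i → f (Fin.suc i))

ΣSub : {n : ℕ} → Subset n → (Fin n → ℤ) → ℤ
ΣSub []             f = + 0
ΣSub (inside  ∷ I) f = f Fin.zero + ΣSub I (λ i → f (Fin.suc i))
ΣSub (outside ∷ I) f = ΣSub I (λ i → f (Fin.suc i))

commonPart : (B : ℤ → ℤ)
  (k₁ k₂ : ℕ)
  (s : Fin k₁ → ℤ) (p : Fin k₁ → ℕ) (a : (i : Fin k₁) → Fin (p i) → ℤ)
  (t : Fin k₂ → ℤ) (qq : Fin k₂ → ℕ) (b : (i : Fin k₂) → Fin (qq i) → ℤ)
  (n : ℤ) → ℤ
commonPart B k₁ k₂ s p a t qq b n =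
  Σ k₁ (λ i → B (n - s i - Σ (p i) (λ j → B (n - a i j))))
  + Σ k₂ (λ i → B (- t i + Σ (qq i) (λ j → B (n - b i j))))

Satisfies₁ : (B : ℤ → ℤ) (q : ℕ) (I : Subset q)
  (k₁ k₂ : ℕ)
  (s : Fin k₁ → ℤ) (p : Fin k₁ → ℕ) (a : (i : Fin k₁) → Fin (p i) → ℤ)
  (t : Fin k₂ → ℤ) (qq : Fin k₂ → ℕ) (b : (i : Fin k₂) → Fin (qq i) → ℤ)
  (α ν : ℤ) → Set
Satisfies₁ B q I k₁ k₂ s p a t qq b α ν = ∀ (n : ℤ) →
  B n ≡ commonPart B k₁ k₂ s p a t qq b n
        + B (n - α - ΣSub I (λ j → B (n - + toℕ j))) + ν

Satisfies₂ : (B : ℤ → ℤ) (q : ℕ) (I : Subset q)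
  (k₁ k₂ : ℕ)
  (s : Fin k₁ → ℤ) (p : Fin k₁ → ℕ) (a : (i : Fin k₁) → Fin (p i) → ℤ)
  (t : Fin k₂ → ℤ) (qq : Fin k₂ → ℕ) (b : (i : Fin k₂) → Fin (qq i) → ℤ)
  (α ν : ℤ) → Set
Satisfies₂ B q I k₁ k₂ s p a t qq b α ν = ∀ (n : ℤ) →
  B n ≡ commonPart B k₁ k₂ s p a t qq b n
        + B (- α + ΣSub (Sub.∁ I) (λ j → B (n - + toℕ j))) + ν

module Submission where

-- Write C(m) = ⌈m/q⌉ and, for a subset I ⊆ {0,…,q-1},
-- A(n) = Σ_{j∈I} C(n-j) and A'(n) = Σ_{j∉I} C(n-j).  The two recursions
-- differ only in their last term, R(n - α - A(n)) versus R(-α + A'(n)), so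
-- they are equivalent as soon as n - α - A(n) = -α + A'(n) for every n, i.e.
-- as soon as the q-window sum Σ_{j<q} C(n-j) equals n (Hermite's identity
-- for the ceiling function).

open import Defs
open import Data.Nat using (ℕ; NonZero)
open import Data.Integer using (ℤ)
open import Data.Fin using (Fin)
open import Data.Fin.Subset using (Subset)
open import Function.Bundles using (_⇔_)

import Data.Nat as ℕ
open import Data.Nat.DivMod using (m<n⇒m/n≡0)
open import Data.Integer
  using (+_; -[1+_]; 0ℤ; _+_; _-_; _*_; -_; _/ℕ_; _≤_; _<_; suc; pred)
open import Data.Integer.Properties
  using ( ≤-antisym; ≤-<-trans; *-cancelʳ-<-nonNeg; i<j⇒i≤pred[j]; pred-suc
        ; suc-pred; suc-*; +-monoˡ-≤; +-monoˡ-<; neg-involutive; +-identityʳ; +-identityˡ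
        ; +-assoc; +-comm; module ≤-Reasoning)
open import Data.Integer.DivMod using ([n/ℕd]*d≤n; n<s[n/ℕd]*d)
open import Data.Integer.Tactic.RingSolver using (solve-∀)
open import Data.Fin as Fin using (toℕ; inject₁; fromℕ)
open import Data.Fin.Properties using (toℕ-inject₁; toℕ-fromℕ; toℕ<n)
open import Data.Vec using ([]; _∷_)
open import Data.Fin.Subset using (inside; outside; ∁)
open import Relation.Binary.PropositionalEquality
  using (_≡_; refl; sym; trans; cong; cong₂; subst; module ≡-Reasoning)
open import Function.Bundles using (mk⇔)

<-suc⇒≤ : ∀ {i j} → i < suc j → i ≤ j
<-suc⇒≤ {i} {j} i<sj = subst (i ≤_) (pred-suc j) (i<j⇒i≤pred[j] i<sj)

unit-steps⇒id : (f : ℤ → ℤ) → f 0ℤ ≡ 0ℤ → (∀ n → f (suc n) ≡ suc (f n))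
  → ∀ n → f n ≡ n
unit-steps⇒id f f0 step (+ ℕ.zero)  = f0
unit-steps⇒id f f0 step (+ ℕ.suc k) =
  trans (step (+ k)) (cong suc (unit-steps⇒id f f0 step (+ k)))
unit-steps⇒id f f0 step -[1+ k ]    = negative k
  where
  step-down : ∀ n → f (pred n) ≡ pred (f n)
  step-down n = begin
    f (pred n)               ≡⟨ sym (pred-suc (f (pred n))) ⟩
    pred (suc (f (pred n)))  ≡⟨ cong pred (sym (step (pred n))) ⟩
    pred (f (suc (pred n)))  ≡⟨ cong (λ m → pred (f m)) (suc-pred n) ⟩
    pred (f n)               ∎
    where
    open ≡-Reasoning
  negative : ∀ k → f -[1+ k ] ≡ -[1+ k ]
  negative ℕ.zero    = trans (step-down 0ℤ) (cong pred f0)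
  negative (ℕ.suc k) = trans (step-down -[1+ k ]) (cong pred (negative k))

/ℕ-unique : ∀ {q} .{{_ : NonZero q}} (x m : ℤ)
  → m * + q ≤ x → x < suc m * + q → x /ℕ q ≡ m
/ℕ-unique {q} x m mq≤x x<[m+1]q = ≤-antisym quotient≤m m≤quotient
  where
  quotient≤m : x /ℕ q ≤ m
  quotient≤m = <-suc⇒≤ (*-cancelʳ-<-nonNeg (+ q) (≤-<-trans ([n/ℕd]*d≤n x q) x<[m+1]q))
  m≤quotient : m ≤ x /ℕ q
  m≤quotient = <-suc⇒≤ (*-cancelʳ-<-nonNeg (+ q) (≤-<-trans mq≤x (n<s[n/ℕd]*d x q)))

/ℕ-shift : ∀ {q} .{{_ : NonZero q}} (y : ℤ) → (y + + q) /ℕ q ≡ suc (y /ℕ q)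
/ℕ-shift {q} y = /ℕ-unique (y + + q) (suc d) lower upper
  where
  open ≤-Reasoning
  d = y /ℕ q
  lower : suc d * + q ≤ y + + q
  lower = begin
    suc d * + q   ≡⟨ suc-* d (+ q) ⟩
    + q + d * + q ≡⟨ +-comm (+ q) (d * + q) ⟩
    d * + q + + q ≤⟨ +-monoˡ-≤ (+ q) ([n/ℕd]*d≤n y q) ⟩
    y + + q       ∎
  upper : y + + q < suc (suc d) * + q
  upper = begin-strict
    y + + q               <⟨ +-monoˡ-< (+ q) (n<s[n/ℕd]*d y q) ⟩
    suc d * + q + + q     ≡⟨ +-comm (suc d * + q) (+ q) ⟩
    + q + suc d * + q     ≡⟨ suc-* (suc d) (+ q) ⟨
    suc (suc d) * + q     ∎

ceilDiv-shift : ∀ {q} .{{_ : NonZero q}} (x : ℤ) → ceilDiv (x + + q) q ≡ suc (ceilDiv x q)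
ceilDiv-shift {q} x = begin
  - (y /ℕ q)                ≡⟨ negate-pred (y /ℕ q) ⟩
  suc (- suc (y /ℕ q))      ≡⟨ cong (λ z → suc (- z)) (/ℕ-shift y) ⟨
  suc (- ((y + + q) /ℕ q))  ≡⟨ cong (λ z → suc (- (z /ℕ q))) (y+q≡-x x (+ q)) ⟩
  suc (- ((- x) /ℕ q))      ∎
  where
  open ≡-Reasoning
  y = - (x + + q)
  negate-pred : ∀ z → - z ≡ + 1 + (- (+ 1 + z))
  negate-pred = solve-∀
  y+q≡-x : ∀ x q → - (x + q) + q ≡ - x
  y+q≡-x = solve-∀

ceilDiv-small : ∀ {q} .{{_ : NonZero q}} (j : ℕ) → j ℕ.< q → ceilDiv (- + j) q ≡ 0ℤ
ceilDiv-small {q} j j<q = begin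
  - ((- - + j) /ℕ q) ≡⟨ cong (λ z → - (z /ℕ q)) (neg-involutive (+ j)) ⟩
  - + (j ℕ./ q)      ≡⟨ cong (λ z → - + z) (m<n⇒m/n≡0 j<q) ⟩
  0ℤ                 ∎
  where open ≡-Reasoning

Σ-cong : ∀ k {f g : Fin k → ℤ} → (∀ i → f i ≡ g i) → Σ k f ≡ Σ k g
Σ-cong ℕ.zero    f≡g = refl
Σ-cong (ℕ.suc k) f≡g = cong₂ _+_ (f≡g Fin.zero) (Σ-cong k (λ i → f≡g (Fin.suc i)))

Σ-zero : ∀ k {f : Fin k → ℤ} → (∀ i → f i ≡ 0ℤ) → Σ k f ≡ 0ℤ
Σ-zero ℕ.zero    f≡0 = refl
Σ-zero (ℕ.suc k) f≡0 = cong₂ _+_ (f≡0 Fin.zero) (Σ-zero k (λ i → f≡0 (Fin.suc i)))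

Σ-last : ∀ k (f : Fin (ℕ.suc k) → ℤ) → Σ (ℕ.suc k) f ≡ Σ k (λ i → f (inject₁ i)) + f (fromℕ k)
Σ-last ℕ.zero    f = +-comm (f Fin.zero) 0ℤ
Σ-last (ℕ.suc k) f = begin
  f Fin.zero + Σ (ℕ.suc k) (λ i → f (Fin.suc i))
    ≡⟨ cong (_+_ (f Fin.zero)) (Σ-last k (λ i → f (Fin.suc i))) ⟩
  f Fin.zero + (Σ k (λ i → f (Fin.suc (inject₁ i))) + f (fromℕ (ℕ.suc k)))
    ≡⟨ +-assoc (f Fin.zero) _ _ ⟨
  Σ (ℕ.suc k) (λ i → f (inject₁ i)) + f (fromℕ (ℕ.suc k)) ∎
  where open ≡-Reasoning

ΣSub-∁ : ∀ {k} (I : Subset k) (f : Fin k → ℤ) → ΣSub I f + ΣSub (∁ I) f ≡ Σ k f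
ΣSub-∁ []            f = refl
ΣSub-∁ (inside ∷ I)  f = trans (+-assoc (f Fin.zero) _ _)
                               (cong (_+_ (f Fin.zero)) (ΣSub-∁ I (λ i → f (Fin.suc i))))
ΣSub-∁ (outside ∷ I) f = begin
  ΣSub I g + (f Fin.zero + ΣSub (∁ I) g) ≡⟨ swap (ΣSub I g) (f Fin.zero) (ΣSub (∁ I) g) ⟩
  f Fin.zero + (ΣSub I g + ΣSub (∁ I) g) ≡⟨ cong (_+_ (f Fin.zero)) (ΣSub-∁ I g) ⟩
  f Fin.zero + Σ _ g                     ∎
  where
  open ≡-Reasoning
  g = λ i → f (Fin.suc i)
  swap : ∀ x y z → x + (y + z) ≡ y + (x + z)
  swap = solve-∀

windowSum : (B : ℤ → ℤ) (q : ℕ) → ℤ → ℤ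
windowSum B q n = Σ q (λ j → B (n - + toℕ j))

hermite : ∀ q .{{_ : NonZero q}} (n : ℤ) → windowSum (λ m → ceilDiv m q) q n ≡ n
hermite q@(ℕ.suc k) = unit-steps⇒id (windowSum C q) window-zero window-step
  where
  C = λ m → ceilDiv m q
  window-zero : windowSum C q 0ℤ ≡ 0ℤ
  window-zero = Σ-zero q (λ j →
    trans (cong C (+-identityˡ (- + toℕ j))) (ceilDiv-small (toℕ j) (toℕ<n j)))
  -- The terms j = 1, …, q-1 of the window at n+1 are the terms
  -- j = 0, …, q-2 of the window at n.
  inner : ℤ → ℤ
  inner n = Σ k (λ i → C (n - + toℕ i))
  window-first : ∀ n → windowSum C q (suc n) ≡ C (suc n) + inner n
  window-first n = cong₂ _+_ (cong C (+-identityʳ (suc n)))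
                             (Σ-cong k (λ i → cong C (drop-suc n (+ toℕ i))))
    where
    drop-suc : ∀ n t → (+ 1 + n) - (+ 1 + t) ≡ n - t
    drop-suc = solve-∀
  window-last : ∀ n → windowSum C q n ≡ inner n + C (n - + k)
  window-last n = trans (Σ-last k (λ j → C (n - + toℕ j)))
    (cong₂ _+_ (Σ-cong k (λ i → cong (λ t → C (n - + t)) (toℕ-inject₁ i)))
               (cong (λ t → C (n - + t)) (toℕ-fromℕ k)))
  -- Passing from n to n+1 the window gains C(n+1) = C(n+1-q) + 1 and
  -- loses C(n+1-q).
  window-step : ∀ n → windowSum C q (suc n) ≡ suc (windowSum C q n)
  window-step n = begin
    windowSum C q (suc n)      ≡⟨ window-first n ⟩
    C (suc n) + inner n        ≡⟨ cong (λ z → C z + inner n) (last-index n (+ k)) ⟨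
    C (n - + k + + q) + inner n ≡⟨ cong (_+ inner n) (ceilDiv-shift (n - + k)) ⟩
    suc (C (n - + k)) + inner n ≡⟨ reorder (C (n - + k)) (inner n) ⟩
    suc (inner n + C (n - + k)) ≡⟨ cong suc (window-last n) ⟨
    suc (windowSum C q n)      ∎
    where
    open ≡-Reasoning
    last-index : ∀ n k → n - k + (+ 1 + k) ≡ + 1 + n
    last-index = solve-∀
    reorder : ∀ c g → (+ 1 + c) + g ≡ + 1 + (g + c)
    reorder = solve-∀

last-arguments-agree : (B : ℤ → ℤ) (q : ℕ) (I : Subset q)
  → (∀ n → windowSum B q n ≡ n)
  → ∀ α n → n - α - ΣSub I (λ j → B (n - + toℕ j))
            ≡ - α + ΣSub (∁ I) (λ j → B (n - + toℕ j))
last-arguments-agree B q I window α n = begin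
  n - α - A         ≡⟨ cong (λ z → z - α - A) (trans (sym (window n)) (sym (ΣSub-∁ I f))) ⟩
  A + A' - α - A    ≡⟨ cancel A A' α ⟩
  - α + A'          ∎
  where
  open ≡-Reasoning
  f = λ j → B (n - + toℕ j)
  A = ΣSub I f
  A' = ΣSub (∁ I) f
  cancel : ∀ A A' α → A + A' - α - A ≡ - α + A'
  cancel = solve-∀

recursions-equivalent : (B : ℤ → ℤ) (q : ℕ) (I : Subset q)
  (k₁ k₂ : ℕ)
  (s : Fin k₁ → ℤ) (p : Fin k₁ → ℕ) (a : (i : Fin k₁) → Fin (p i) → ℤ)
  (t : Fin k₂ → ℤ) (qq : Fin k₂ → ℕ) (b : (i : Fin k₂) → Fin (qq i) → ℤ)
  (α ν : ℤ)
  → (∀ n → windowSum B q n ≡ n)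
  → Satisfies₁ B q I k₁ k₂ s p a t qq b α ν ⇔ Satisfies₂ B q I k₁ k₂ s p a t qq b α ν
recursions-equivalent B q I k₁ k₂ s p a t qq b α ν window = mk⇔
  (λ rec₁ n → trans (rec₁ n) (last-term-agrees n))
  (λ rec₂ n → trans (rec₂ n) (sym (last-term-agrees n)))
  where
  last-term-agrees : ∀ n →
    commonPart B k₁ k₂ s p a t qq b n + B (n - α - ΣSub I (λ j → B (n - + toℕ j))) + ν
    ≡ commonPart B k₁ k₂ s p a t qq b n + B (- α + ΣSub (∁ I) (λ j → B (n - + toℕ j))) + ν
  last-term-agrees n =
    cong (λ z → commonPart B k₁ k₂ s p a t qq b n + B z + ν)
         (last-arguments-agree B q I window α n)

theorem9 : (q : ℕ) → .{{_ : NonZero q}} → (I : Subset q)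
    → (k₁ k₂ : ℕ)
    → (s : Fin k₁ → ℤ) (p : Fin k₁ → ℕ) (a : (i : Fin k₁) → Fin (p i) → ℤ)
    → (t : Fin k₂ → ℤ) (qq : Fin k₂ → ℕ) (b : (i : Fin k₂) → Fin (qq i) → ℤ)
    → (α ν : ℤ)
    → Satisfies₁ (λ m → ceilDiv m q) q I k₁ k₂ s p a t qq b α ν
      ⇔ Satisfies₂ (λ m → ceilDiv m q) q I k₁ k₂ s p a t qq b α ν
theorem9 q I k₁ k₂ s p a t qq b α ν =
  recursions-equivalent (λ m → ceilDiv m q) q I k₁ k₂ s p a t qq b α ν (hermite q)
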